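{- Let $a$ and $b$ be positive integers, and for $x\in\mathbb{N}$ let $g_{a,b}(x)=\bigl(\lfloor\sqrt[a]{x}\rfloor+1\bigr)^b-1$. Then $g_{a,b}^+(y)=\lfloor\sqrt[b]{y}\rfloor^a$ for all non-negative integers $y$.
   Context: $\mathbb{N}$ denotes the non-negative integers. For an unbounded function $g\colon\mathbb{N}\to\mathbb{N}$, $g^+(y)$ denotes the smallest $x\in\mathbb{N}$ such that $g(x)\ge y$. -}

module Defs where

open import Data.Nat using (ℕ; zero; suc; _+_; _∸_; _^_; _≤_; _<_; _≥_; _≤?_)
open import Relation.Nullary using (yes; no)

rootSearch : ℕ → ℕ → ℕ → ℕ
rootSearch a x zero = zero
rootSearch a x (suc k) with suc k ^ a ≤? x
... | yes _ = suc k
... | no  _ = rootSearch a x k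

-- ⌊ x^(1/a) ⌋ ; for a ≥ 1 the root is ≤ x, so searching r ∈ [0, x] suffices.
iroot : ℕ → ℕ → ℕ
iroot a x = rootSearch a x x

g : ℕ → ℕ → ℕ → ℕ
g a b x = (iroot a x + 1) ^ b ∸ 1

-- IsLeastWith f y m : m is the smallest natural number with f m ≥ y,
-- i.e.  m = f⁺(y).
record IsUpperInverseAt (f : ℕ → ℕ) (y m : ℕ) : Set where
  field
    reaches : f m ≥ y
    least   : ∀ x → f x ≥ y → m ≤ x

module Submission where

-- The theorem says that  y ↦ ⌊y^(1/b)⌋^a  is the upper inverse of
-- g(x) = (⌊x^(1/a)⌋ + 1)^b - 1.  Both functions are built from the integer
-- root, and the proof is a chain of Galois connections:
--
--   * `iroot-galois`: for a ≥ 1 the integer root is right adjoint to the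
--     a-th power,  s^a ≤ x ⇔ s ≤ ⌊x^(1/a)⌋  (from the search defining `iroot`);
--   * negating it gives  y < t^b ⇔ ⌊y^(1/b)⌋ < t  (`below-power`);
--   * chaining these through  y ≤ n - 1 ⇔ y < n  yields the adjunction for g,
--       y ≤ g(x)  ⇔  ⌊y^(1/b)⌋^a ≤ x          (`g-galois`);
--   * a function with such an adjunction at y has that left adjoint value as
--     its upper inverse at y (`upperInverse-from-galois`), which is the theorem.

open import Defs
open import Data.Nat using (ℕ; _^_; _≤_; _<_)
open import Data.Nat using (zero; suc; pred; z≤n; s≤s; _≤?_; >-nonZero)
open import Data.Nat.Properties
open import Data.Sum using (inj₁; inj₂)
open import Data.Empty using (⊥-elim)
open import Function.Bundles using (_⇔_; mk⇔; module Equivalence)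
open import Function.Properties.Equivalence using () renaming (trans to ⇔-trans; sym to ⇔-sym)
open import Relation.Nullary using (yes; no)
open import Relation.Binary.PropositionalEquality using (refl)

open Equivalence using (to; from)

-- For a positive exponent, powers dominate their base; this bounds every
-- candidate root by x, so the search in `iroot` (over [0, x]) sees all of them.
n≤n^a : ∀ a n → 1 ≤ a → n ≤ n ^ a
n≤n^a (suc a) zero    _ = z≤n
n≤n^a (suc a) (suc n) _ = m≤m*n (suc n) (suc n ^ a) {{>-nonZero (m^n>0 (suc n) a)}}

-- The search result is a genuine root candidate.  (The fallback value 0 is
-- one only because a ≥ 1, i.e. 0 ^ a = 0.)
rootSearch-sound : ∀ a x k → 1 ≤ a → rootSearch a x k ^ a ≤ x
rootSearch-sound (suc a) x zero _ = z≤n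
rootSearch-sound a x (suc k) a≥1 with suc k ^ a ≤? x
... | yes k+1^a≤x = k+1^a≤x
... | no  _       = rootSearch-sound a x k a≥1

rootSearch-complete : ∀ a x k s → s ≤ k → s ^ a ≤ x → s ≤ rootSearch a x k
rootSearch-complete a x zero .zero z≤n _ = z≤n
rootSearch-complete a x (suc k) s s≤k+1 s^a≤x with suc k ^ a ≤? x
... | yes _ = s≤k+1
... | no k+1^a≰x with m≤n⇒m<n∨m≡n s≤k+1
...   | inj₁ (s≤s s≤k) = rootSearch-complete a x k s s≤k s^a≤x
...   | inj₂ refl      = ⊥-elim (k+1^a≰x s^a≤x)

iroot-galois : ∀ {a x s} → 1 ≤ a → (s ^ a ≤ x ⇔ s ≤ iroot a x)
iroot-galois {a} {x} {s} a≥1 = mk⇔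
  (λ s^a≤x → rootSearch-complete a x x s (≤-trans (n≤n^a a s a≥1) s^a≤x) s^a≤x)
  (λ s≤r → ≤-trans (^-monoˡ-≤ a s≤r) (rootSearch-sound a x x a≥1))

below-power : ∀ {b y t} → 1 ≤ b → (y < t ^ b ⇔ iroot b y < t)
below-power b≥1 = mk⇔
  (λ y<t^b → ≰⇒> (λ t≤r → <⇒≱ y<t^b (from (iroot-galois b≥1) t≤r)))
  (λ r<t → ≰⇒> (λ t^b≤y → <⇒≱ r<t (to (iroot-galois b≥1) t^b≤y)))

below-pred : ∀ {y n} → 0 < n → (y ≤ pred n ⇔ y < n)
below-pred {n = suc _} _ = mk⇔ s≤s m<1+n⇒m≤n

g-galois : ∀ {a b x y} → 1 ≤ a → 1 ≤ b → (y ≤ g a b x ⇔ iroot b y ^ a ≤ x)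
g-galois {a} {b} {x} {y} a≥1 b≥1 rewrite +-comm (iroot a x) 1 =
  ⇔-trans (below-pred (m^n>0 (suc r) b))          -- y < (r + 1)^b
  (⇔-trans (below-power b≥1)                       -- ⌊y^(1/b)⌋ < r + 1
  (⇔-trans (mk⇔ m<1+n⇒m≤n s≤s)                    -- ⌊y^(1/b)⌋ ≤ r
           (⇔-sym (iroot-galois a≥1))))            -- ⌊y^(1/b)⌋^a ≤ x
  where r = iroot a x

upperInverse-from-galois : ∀ {f : ℕ → ℕ} {y m} →
  (∀ x → y ≤ f x ⇔ m ≤ x) → IsUpperInverseAt f y m
upperInverse-from-galois {m = m} adj = record
  { reaches = from (adj m) ≤-refl
  ; least   = λ x y≤fx → to (adj x) y≤fx
  }

lemma5p2 : ∀ (a b : ℕ) → 1 ≤ a → 1 ≤ b → ∀ (y : ℕ) →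
    IsUpperInverseAt (g a b) y (iroot b y ^ a)
lemma5p2 a b a≥1 b≥1 y = upperInverse-from-galois (λ x → g-galois a≥1 b≥1)
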